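{- Let $G$ be an $n$-vertex connected graph of diameter at most $n-3$. Then for every $v\in V_G$, $D_G(v)\leqslant (n^2-n-6)/2$, with equality if and only if $G\in\{A_{n,3}^i: i=0,1,2,3\}$ and $v$ is a non-unit leaf of $A_{n,3}^i$ (i.e. the end-vertex of the path of length $n-4$ other than the maximum-degree vertex).
   Context: $D_G(v)=\sum_{x\in V_G}d_G(x,v)$. $A_{n,3}$ denotes the $n$-vertex tree obtained from a path of length $n-4$ by attaching three pendant vertices (the unit leaves) to one of its end-vertices (the maximum-degree vertex). For $i\in\{0,1,2,3\}$, $A_{n,3}^i$ is a graph obtained from $A_{n,3}$ by adding $i$ edges among its three unit leaves. A non-unit leaf is a leaf not adjacent to the maximum-degree vertex. -}

module Defs where

open import Data.Nat using (ℕ; zero; suc; _+_; _*_; _∸_; _≤_; _<_)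
open import Data.Fin using (Fin; toℕ)
open import Data.List using (List; map; allFin)
open import Data.Nat.ListAction using (sum)
open import Data.Product using (Σ; _×_; ∃)
open import Data.Sum using (_⊎_)
open import Data.Empty using (⊥)
open import Data.Unit using (⊤)
open import Relation.Nullary using (¬_)
open import Relation.Binary.PropositionalEquality using (_≡_)
open import Function.Bundles using (_↔_; Inverse)
open import Level using (0ℓ)

record Graph (n : ℕ) : Set₁ where
  field
    Adj     : Fin n → Fin n → Set
    sym     : ∀ {x y} → Adj x y → Adj y x
    irrefl  : ∀ {x} → ¬ Adj x x

open Graph public

data Walk {n : ℕ} (G : Graph n) : Fin n → Fin n → ℕ → Set where
  [] : ∀ {x} → Walk G x x 0
  _∷_ : ∀ {x y z k} → Adj G x y → Walk G y z k → Walk G x z (suc k)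

Connected : ∀ {n} → Graph n → Set
Connected {n} G = ∀ (x y : Fin n) → ∃ λ k → Walk G x y k

IsDistance : ∀ {n} → Graph n → (Fin n → Fin n → ℕ) → Set
IsDistance {n} G d =
  ∀ (x y : Fin n) → Walk G x y (d x y) × (∀ k → Walk G x y k → d x y ≤ k)

DiamAtMost : ∀ {n} → (Fin n → Fin n → ℕ) → ℕ → Set
DiamAtMost {n} d m = ∀ (x y : Fin n) → d x y ≤ m

Trans : ∀ {n} → (Fin n → Fin n → ℕ) → Fin n → ℕ
Trans {n} d v = sum (map (λ x → d x v) (allFin n))

Iso : ∀ {n} → Graph n → (Fin n → Fin n → Set) → (Fin n ↔ Fin n) → Set
Iso G H f = ∀ x y → (Adj G x y → H (Inverse.to f x) (Inverse.to f y))
                  × (H (Inverse.to f x) (Inverse.to f y) → Adj G x y)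

-- The graphs A_{n,3}^i, labelled as follows (n ≥ 5):
--   path vertices 0,1,...,n-4 (path of length n-4), vertex 0 is the
--   non-unit leaf, vertex c = n-4 is the maximum-degree vertex;
--   unit leaves n-3, n-2, n-1, each adjacent to c.
--   i = 0,1,2,3 extra edges among the unit leaves:
--   i ≥ 1 : {n-3,n-2};  i ≥ 2 : also {n-2,n-1};  i = 3 : also {n-3,n-1}.

AEdge : ℕ → ℕ → ℕ → ℕ → Set
AEdge n i a b =
    (suc a ≡ b × b ≤ n ∸ 4)
  ⊎ (a ≡ n ∸ 4 × (n ∸ 3 ≤ b × b < n))
  ⊎ (1 ≤ i × (a ≡ n ∸ 3 × b ≡ n ∸ 2))
  ⊎ (2 ≤ i × (a ≡ n ∸ 2 × b ≡ n ∸ 1))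
  ⊎ (3 ≤ i × (a ≡ n ∸ 3 × b ≡ n ∸ 1))

AAdj : (n i : ℕ) → Fin n → Fin n → Set
AAdj n i x y = AEdge n i (toℕ x) (toℕ y) ⊎ AEdge n i (toℕ y) (toℕ x)

-- Write h x = d(x, v) and B = n − 3 ≥ h. Every value below an attained value of h is attained
-- (along a shortest path), so for 1 ≤ k ≤ B at least k vertices have h < k, i.e.
-- #{x : h x ≥ k} + k ≤ n. Summing over k, D(v) = Σ_k #{x : h x ≥ k} gives
-- 2 D(v) ≤ 2 B n − B (B + 1) = n² − n − 6. In the equality case every such count is tight:
-- the levels 0, …, n − 4 are singletons and level n − 3 has three vertices. Labelling the
-- singletons by their distance and the three top vertices by n − 3, n − 2, n − 1, ordered so that
-- the edges among them are nested as in A_{n,3}^i, is an isomorphism onto A_{n,3}^i taking v to 0.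
-- Conversely, in A_{n,3}^i the distance to the non-unit leaf 0 dominates min(label, n − 3), and
-- these minima sum to exactly (n² − n − 6)/2.

module Submission where

open import Defs hiding (sym)

open import Data.Bool.Base using (true; false; if_then_else_)
open import Data.Fin as Fin using (Fin; zero; suc; toℕ; fromℕ<; punchOut)
open import Data.Fin.Patterns using (0F; 1F; 2F)
open import Data.Fin.Permutation using (Permutation′; _⟨$⟩ʳ_; _⟨$⟩ˡ_; inverseʳ; transpose)
open import Data.Fin.Properties
  using (any?; toℕ<n; toℕ-fromℕ<; toℕ-injective; punchOut-injective; injective⇒≤)
open import Data.List using (List; []; _∷_; length; lookup; map; filter; tabulate; allFin)
open import Data.List.Properties using (map-tabulate)
open import Data.List.Membership.Propositional using (_∈_)
open import Data.List.Membership.Propositional.Properties using (∈-filter⁺; ∈-filter⁻; ∈-allFin; ∈-lookup)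
open import Data.List.Relation.Unary.Any using (here; index)
open import Data.List.Relation.Unary.Any.Properties using (lookup-index)
open import Data.Nat using (ℕ; zero; suc; _+_; _*_; _∸_; _⊓_; _≤_; _<_; z≤n; s≤s)
import Data.Nat.ListAction as List
open import Data.Nat.Properties
open import Data.Nat.Tactic.RingSolver using (solve-∀)
open import Data.Product using (_×_; _,_; proj₁; proj₂; ∃; ∃₂; Σ)
open import Data.Sum using (_⊎_; inj₁; inj₂)
open import Function.Base using (_∘_)
open import Function.Bundles using (_⇔_; mk⇔; Equivalence; _↔_; mk↔ₛ′; Inverse)
open import Function.Definitions using (Injective)
import Function.Properties.Equivalence as ⇔
open import Level using (_⊔_)
open import Relation.Nullary using (¬_; Dec; does; yes; no; contradiction)
import Relation.Nullary.Decidable as Dec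
open import Relation.Unary using (Pred; Decidable)
import Relation.Binary.Definitions as B
open import Relation.Binary.Definitions using (tri<; tri≈; tri>)
open import Relation.Binary.PropositionalEquality

open import Algebra.Properties.CommutativeMonoid.Sum +-0-commutativeMonoid
  using (sum-syntax; sum-cong-≗; sum-replicate-zero; ∑-distrib-+; ∑-comm; ∑-permute)

sum-map-allFin : ∀ {n} (f : Fin n → ℕ) → List.sum (map f (allFin n)) ≡ ∑[ x < n ] f x
sum-map-allFin {n} f = trans (cong List.sum (map-tabulate (λ x → x) f)) (sum-tabulate f)
  where
  sum-tabulate : ∀ {k} (g : Fin k → ℕ) → List.sum (tabulate g) ≡ ∑[ x < k ] g x
  sum-tabulate {zero} g = refl
  sum-tabulate {suc k} g = cong (g zero +_) (sum-tabulate (g ∘ suc))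

∑-const : ∀ n c → ∑[ x < n ] c ≡ n * c
∑-const zero c = refl
∑-const (suc n) c = cong (c +_) (∑-const n c)

∑-mono-≤ : ∀ {n} {f g : Fin n → ℕ} → (∀ x → f x ≤ g x) → ∑[ x < n ] f x ≤ ∑[ x < n ] g x
∑-mono-≤ {zero} f≤g = z≤n
∑-mono-≤ {suc n} f≤g = +-mono-≤ (f≤g zero) (∑-mono-≤ (f≤g ∘ suc))

∑-≤-* : ∀ {n c} {f : Fin n → ℕ} → (∀ x → f x ≤ c) → ∑[ x < n ] f x ≤ n * c
∑-≤-* {n} {c} f≤c = ≤-trans (∑-mono-≤ f≤c) (≤-reflexive (∑-const n c))

∑≡*⇒≡ : ∀ {n c} {f : Fin n → ℕ} → (∀ x → f x ≤ c) → ∑[ x < n ] f x ≡ n * c → ∀ x → f x ≡ c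
∑≡*⇒≡ {suc n} {c} {f} f≤c ∑≡ = λ
  { zero → head≡
  ; (suc x) → ∑≡*⇒≡ (f≤c ∘ suc) (+-cancelˡ-≡ c _ _ (trans (cong (_+ _) (sym head≡)) ∑≡)) x }
  where
  rest≤ : ∑[ x < n ] f (suc x) ≤ n * c
  rest≤ = ∑-≤-* (f≤c ∘ suc)
  head≡ : f zero ≡ c
  head≡ = ≤-antisym (f≤c zero) (+-cancelʳ-≤ _ _ _ (begin
    c + ∑[ x < n ] f (suc x) ≤⟨ +-monoʳ-≤ c rest≤ ⟩
    c + n * c                ≡⟨ sym ∑≡ ⟩
    f zero + ∑[ x < n ] f (suc x) ∎))
    where open ≤-Reasoning

∑-suc : ∀ {n} (f : Fin n → ℕ) → ∑[ x < n ] suc (f x) ≡ n + ∑[ x < n ] f x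
∑-suc {zero} f = refl
∑-suc {suc n} f = trans (cong (suc (f zero) +_) (∑-suc (f ∘ suc))) (rearrange (f zero) n _)
  where
  rearrange : ∀ a n s → suc a + (n + s) ≡ suc n + (a + s)
  rearrange = solve-∀

gauss : ∀ n → 2 * ∑[ k < n ] suc (toℕ k) ≡ n * suc n
gauss zero = refl
gauss (suc n) = begin
  2 * (1 + ∑[ k < n ] suc (suc (toℕ k))) ≡⟨ cong (λ s → 2 * (1 + s)) (∑-suc {n} (suc ∘ toℕ)) ⟩
  2 * (1 + (n + S))                        ≡⟨ expand n S ⟩
  2 * S + 2 * suc n                        ≡⟨ cong (_+ 2 * suc n) (gauss n) ⟩
  n * suc n + 2 * suc n                    ≡⟨ collect n ⟩
  suc n * suc (suc n)                      ∎
  where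
  open ≡-Reasoning
  S : ℕ
  S = ∑[ k < n ] suc (toℕ k)
  expand : ∀ n s → 2 * (1 + (n + s)) ≡ 2 * s + 2 * suc n
  expand = solve-∀
  collect : ∀ n → n * suc n + 2 * suc n ≡ suc n * suc (suc n)
  collect = solve-∀

∀-Fin⇒∀-< : ∀ {n} (P : ℕ → Set) → (∀ (k : Fin n) → P (toℕ k)) → ∀ k → k < n → P k
∀-Fin⇒∀-< P all k k<n = subst P (toℕ-fromℕ< k<n) (all (fromℕ< k<n))

𝟙 : ∀ {a} {A : Set a} → Dec A → ℕ
𝟙 a? = if does a? then 1 else 0

𝟙-no : ∀ {a} {A : Set a} (a? : Dec A) → ¬ A → 𝟙 a? ≡ 0
𝟙-no (yes a) ¬a = contradiction a ¬a
𝟙-no (no _) _ = refl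

count : ∀ {n p} {P : Pred (Fin n) p} → Decidable P → ℕ
count {n} P? = ∑[ x < n ] 𝟙 (P? x)

count-pos : ∀ {n p} {P : Pred (Fin n) p} (P? : Decidable P) {x} → P x → 1 ≤ count P?
count-pos P? {zero} Px with P? zero
... | yes _ = s≤s z≤n
... | no ¬Px = contradiction Px ¬Px
count-pos P? {suc x} Px = ≤-trans (count-pos (P? ∘ suc) Px) (m≤n+m _ _)

count-none : ∀ {n p} {P : Pred (Fin n) p} (P? : Decidable P) → (∀ x → ¬ P x) → count P? ≡ 0
count-none {n} P? none = trans (sum-cong-≗ (λ x → 𝟙-no (P? x) (none x))) (sum-replicate-zero n)

length-filter-allFin : ∀ {n p} {P : Pred (Fin n) p} (P? : Decidable P) →
  length (filter P? (allFin n)) ≡ count P?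
length-filter-allFin P? = length-filter-tabulate (λ x → x)
  where
  length-filter-tabulate : ∀ {k} (f : Fin k → Fin _) →
    length (filter P? (tabulate f)) ≡ ∑[ x < k ] 𝟙 (P? (f x))
  length-filter-tabulate {zero} f = refl
  length-filter-tabulate {suc k} f with does (P? (f zero))
  ... | true = cong suc (length-filter-tabulate (f ∘ suc))
  ... | false = length-filter-tabulate (f ∘ suc)

∈-filter-allFin : ∀ {n p} {P : Pred (Fin n) p} (P? : Decidable P) {x} → x ∈ filter P? (allFin n) ⇔ P x
∈-filter-allFin {n} P? {x} = mk⇔ (proj₂ ∘ ∈-filter⁻ P? {xs = allFin n}) (∈-filter⁺ P? (∈-allFin x))

𝟙-suc≤?suc : ∀ k a → 𝟙 (suc k ≤? suc a) ≡ 𝟙 (k ≤? a)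
𝟙-suc≤?suc zero a = refl
𝟙-suc≤?suc (suc k) a = refl

𝟙-≤?-split : ∀ k a → 𝟙 (k ≤? a) ≡ 𝟙 (a ≟ k) + 𝟙 (suc k ≤? a)
𝟙-≤?-split zero zero = refl
𝟙-≤?-split zero (suc a) = refl
𝟙-≤?-split (suc k) zero = refl
𝟙-≤?-split (suc k) (suc a) = trans (𝟙-suc≤?suc k a) (𝟙-≤?-split k a)

∑-𝟙-suc≤?≡⊓ : ∀ B a → ∑[ k < B ] 𝟙 (suc (toℕ k) ≤? a) ≡ a ⊓ B
∑-𝟙-suc≤?≡⊓ zero a = sym (⊓-zeroʳ a)
∑-𝟙-suc≤?≡⊓ (suc B) zero = sum-replicate-zero B
∑-𝟙-suc≤?≡⊓ (suc B) (suc a) = cong suc (∑-𝟙-suc≤?≡⊓ B a)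

count-≤?-toℕ : ∀ n k → count (λ (x : Fin n) → k ≤? toℕ x) ≡ n ∸ k
count-≤?-toℕ zero k = sym (0∸n≡0 k)
count-≤?-toℕ (suc n) zero = cong suc (count-≤?-toℕ n zero)
count-≤?-toℕ (suc n) (suc k) =
  trans (sum-cong-≗ {n} (λ x → 𝟙-suc≤?suc k (toℕ x))) (count-≤?-toℕ n k)

module _ {n} (h : Fin n → ℕ) where

  layer-cake : ∀ B → ∑[ x < n ] (h x ⊓ B) ≡ ∑[ k < B ] count (λ x → suc (toℕ k) ≤? h x)
  layer-cake B = trans (sum-cong-≗ {n} (λ x → sym (∑-𝟙-suc≤?≡⊓ B (h x))))
                       (∑-comm (λ x (k : Fin B) → 𝟙 (suc (toℕ k) ≤? h x)))

  count-0≤? : count (λ x → 0 ≤? h x) ≡ n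
  count-0≤? = trans (∑-const n 1) (*-identityʳ n)

  count-≤?-split : ∀ k → count (λ x → k ≤? h x) ≡ count (λ x → h x ≟ k) + count (λ x → suc k ≤? h x)
  count-≤?-split k = trans (sum-cong-≗ {n} (λ x → 𝟙-≤?-split k (h x)))
                           (∑-distrib-+ (λ x → 𝟙 (h x ≟ k)) (λ x → 𝟙 (suc k ≤? h x)))

  count-≤?+k≤n : ∀ k → (∀ j → j < k → ∃ λ x → h x ≡ j) → count (λ x → k ≤? h x) + k ≤ n
  count-≤?+k≤n zero _ = ≤-reflexive (trans (+-identityʳ _) count-0≤?)
  count-≤?+k≤n (suc k) levels = begin
    count (λ x → suc k ≤? h x) + suc k     ≡⟨ +-suc _ k ⟩
    suc (count (λ x → suc k ≤? h x)) + k   ≤⟨ +-monoˡ-≤ k (+-monoˡ-≤ _ level-k) ⟩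
    count (λ x → h x ≟ k) + count (λ x → suc k ≤? h x) + k ≡⟨ cong (_+ k) (count-≤?-split k) ⟨
    count (λ x → k ≤? h x) + k             ≤⟨ count-≤?+k≤n k (λ j j<k → levels j (m<n⇒m<1+n j<k)) ⟩
    n                                      ∎
    where
    open ≤-Reasoning
    level-k : 1 ≤ count (λ x → h x ≟ k)
    level-k = let x , hx≡k = levels k ≤-refl in count-pos (λ x → h x ≟ k) hx≡k

∈-singleton-≡ : ∀ {a} {A : Set a} {xs : List A} {x y} → length xs ≡ 1 → x ∈ xs → y ∈ xs → x ≡ y
∈-singleton-≡ {xs = _ ∷ []} _ (here refl) (here refl) = refl

record Triple {a p} {A : Set a} (P : Pred A p) : Set (a ⊔ p) where
  field
    elem   : Fin 3 → A
    elem-P : ∀ j → P (elem j)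
    cover  : ∀ {x} → P x → ∃ λ j → x ≡ elem j

-- The edges among e 0F, e 1F, e 2F as among the unit leaves n − 3, n − 2, n − 1 of A_{n,3}^i.
record ExtraEdges {a r} {A : Set a} (R : A → A → Set r) (i : ℕ) (e : Fin 3 → A) : Set r where
  field
    edge₀₁ : R (e 0F) (e 1F) ⇔ 1 ≤ i
    edge₁₂ : R (e 1F) (e 2F) ⇔ 2 ≤ i
    edge₀₂ : R (e 0F) (e 2F) ⇔ 3 ≤ i

module _ {a p} {A : Set a} {P : Pred A p} where

  triple : (xs : List A) → length xs ≡ 3 → (∀ {x} → P x ⇔ x ∈ xs) → Triple P
  triple (x ∷ y ∷ z ∷ []) refl P⇔∈ = record
    { elem   = lookup (x ∷ y ∷ z ∷ [])
    ; elem-P = λ j → Equivalence.from P⇔∈ (∈-lookup j)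
    ; cover  = λ Px → let x∈ = Equivalence.to P⇔∈ Px in index x∈ , lookup-index x∈
    }

  permute : Permutation′ 3 → Triple P → Triple P
  permute σ t = record
    { elem   = elem ∘ (σ ⟨$⟩ʳ_)
    ; elem-P = elem-P ∘ (σ ⟨$⟩ʳ_)
    ; cover  = λ Px → let j , x≡ = cover Px in σ ⟨$⟩ˡ j , trans x≡ (cong elem (sym (inverseʳ σ)))
    }
    where open Triple t

  -- Up to a transposition, a graph on three vertices is determined by its number of edges.
  arrange : ∀ {r} {R : A → A → Set r} → B.Symmetric R → B.Decidable R → Triple P →
    ∃₂ λ i (t : Triple P) → i ≤ 3 × ExtraEdges R i (Triple.elem t)
  arrange {r} {R} R-sym R? t = go (R? (e 0F) (e 1F)) (R? (e 1F) (e 2F)) (R? (e 0F) (e 2F))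
    where
    e : Fin 3 → A
    e = Triple.elem t

    Decides : ∀ {y x} {Y : Set y} → Dec Y → Set x → Set x
    Decides y? X = if does y? then X else ¬ X

    decides⇔ : ∀ {y} {Y : Set y} {X : Set r} (y? : Dec Y) → Decides y? X → X ⇔ Y
    decides⇔ (yes y) x = mk⇔ (λ _ → y) (λ _ → x)
    decides⇔ (no ¬y) ¬x = mk⇔ (λ x → contradiction x ¬x) (λ y → contradiction y ¬y)

    extraEdges : ∀ i {e} → Decides (1 ≤? i) (R (e 0F) (e 1F)) → Decides (2 ≤? i) (R (e 1F) (e 2F)) →
      Decides (3 ≤? i) (R (e 0F) (e 2F)) → ExtraEdges R i e
    extraEdges i r₀₁ r₁₂ r₀₂ = record
      { edge₀₁ = decides⇔ (1 ≤? i) r₀₁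
      ; edge₁₂ = decides⇔ (2 ≤? i) r₁₂
      ; edge₀₂ = decides⇔ (3 ≤? i) r₀₂
      }

    go : Dec (R (e 0F) (e 1F)) → Dec (R (e 1F) (e 2F)) → Dec (R (e 0F) (e 2F)) →
      ∃₂ λ i (t : Triple P) → i ≤ 3 × ExtraEdges R i (Triple.elem t)
    go (no ¬01) (no ¬12) (no ¬02) = 0 , t , z≤n , extraEdges 0 ¬01 ¬12 ¬02
    go (yes r01) (no ¬12) (no ¬02) = 1 , t , s≤s z≤n , extraEdges 1 r01 ¬12 ¬02
    go (no ¬01) (yes r12) (no ¬02) = 1 , permute (transpose 0F 2F) t , s≤s z≤n ,
      extraEdges 1 (R-sym r12) (¬01 ∘ R-sym) (¬02 ∘ R-sym)
    go (no ¬01) (no ¬12) (yes r02) = 1 , permute (transpose 1F 2F) t , s≤s z≤n ,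
      extraEdges 1 r02 (¬12 ∘ R-sym) ¬01
    go (yes r01) (yes r12) (no ¬02) = 2 , t , s≤s (s≤s z≤n) , extraEdges 2 r01 r12 ¬02
    go (yes r01) (no ¬12) (yes r02) = 2 , permute (transpose 0F 1F) t , s≤s (s≤s z≤n) ,
      extraEdges 2 (R-sym r01) r02 ¬12
    go (no ¬01) (yes r12) (yes r02) = 2 , permute (transpose 1F 2F) t , s≤s (s≤s z≤n) ,
      extraEdges 2 r02 (R-sym r12) ¬01
    go (yes r01) (yes r12) (yes r02) = 3 , t , ≤-refl , extraEdges 3 r01 r12 r02

injective⇒surjective : ∀ {n} {f : Fin n → Fin n} → Injective _≡_ _≡_ f → ∀ y → ∃ λ x → f x ≡ y
injective⇒surjective {suc n} {f} f-inj y with any? (λ x → f x Fin.≟ y)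
... | yes hit = hit
... | no miss = contradiction (injective⇒≤ punchOut∘f-injective) (<-irrefl refl)
  where
  punchOut∘f-injective : Injective _≡_ _≡_ (λ x → punchOut {i = y} (λ y≡fx → miss (x , sym y≡fx)))
  punchOut∘f-injective eq = f-inj (punchOut-injective {i = y} _ _ eq)

injective⇒↔ : ∀ {n} {f : Fin n → Fin n} → Injective _≡_ _≡_ f → Fin n ↔ Fin n
injective⇒↔ {f = f} f-inj =
  mk↔ₛ′ f (proj₁ ∘ preimage) (proj₂ ∘ preimage) (λ x → f-inj (proj₂ (preimage (f x))))
  where
  preimage : ∀ y → ∃ λ x → f x ≡ y
  preimage = injective⇒surjective f-inj

module _ {n} {G : Graph n} where

  walk-0 : ∀ {x y} → Walk G x y 0 → x ≡ y
  walk-0 [] = refl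

  walk-1 : ∀ {x y} → Walk G x y 1 → Adj G x y
  walk-1 (xy ∷ []) = xy

  walk-lipschitz : (ℓ : Fin n → ℕ) → (∀ {x y} → Adj G x y → ℓ x ≤ suc (ℓ y)) →
    ∀ {x y k} → Walk G x y k → ℓ x ≤ k + ℓ y
  walk-lipschitz ℓ ℓ-adj [] = ≤-refl
  walk-lipschitz ℓ ℓ-adj (xy ∷ w) = ≤-trans (ℓ-adj xy) (s≤s (walk-lipschitz ℓ ℓ-adj w))

module Distance {n} (G : Graph n) (d : Fin n → Fin n → ℕ) (isD : IsDistance G d) where

  shortest : ∀ x y → Walk G x y (d x y)
  shortest x y = proj₁ (isD x y)

  minimal : ∀ {x y k} → Walk G x y k → d x y ≤ k
  minimal {x} {y} = proj₂ (isD x y) _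

  d-refl : ∀ x → d x x ≡ 0
  d-refl x = n≤0⇒n≡0 (minimal [])

  d-adj : ∀ {x y} z → Adj G x y → d x z ≤ suc (d y z)
  d-adj {y = y} z xy = minimal (xy ∷ shortest y z)

  predecessor : ∀ x z {k} → d x z ≡ suc k → ∃ λ y → Adj G x y × d y z ≡ k
  predecessor x z {k} dxz≡ with subst (Walk G x z) dxz≡ (shortest x z)
  ... | _∷_ {y = y} xy w = y , xy , ≤-antisym (minimal w) (≤-pred (subst (_≤ suc (d y z)) dxz≡ (d-adj z xy)))

  gap-free : ∀ {x z j} → j < d x z → ∃ λ y → d y z ≡ j
  gap-free {x} {z} {j} j<d = descend (d x z ∸ j) x (sym (m+[n∸m]≡n (<⇒≤ j<d)))
    where
    descend : ∀ t y → d y z ≡ j + t → ∃ λ w → d w z ≡ j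
    descend zero y dyz≡ = y , trans dyz≡ (+-identityʳ j)
    descend (suc t) y dyz≡ = let w , _ , dwz≡ = predecessor y z (trans dyz≡ (+-suc j t)) in descend t w dwz≡

  adj⇔d≡1 : ∀ {x y} → Adj G x y ⇔ d x y ≡ 1
  adj⇔d≡1 {x} {y} = mk⇔ adj⇒d≡1 (λ d≡1 → walk-1 (subst (Walk G x y) d≡1 (shortest x y)))
    where
    adj⇒d≡1 : Adj G x y → d x y ≡ 1
    adj⇒d≡1 xy with d x y in eq
    ... | zero = contradiction (subst (Adj G x) (sym (walk-0 (subst (Walk G x y) eq (shortest x y)))) xy) (irrefl G)
    ... | suc k = cong suc (n≤0⇒n≡0 (≤-pred (subst (_≤ 1) eq (minimal (xy ∷ [])))))

  adj? : B.Decidable (Adj G)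
  adj? x y = Dec.map′ (Equivalence.from adj⇔d≡1) (Equivalence.to adj⇔d≡1) (d x y ≟ 1)

module Transmission (m : ℕ) where

  N B : ℕ
  N = 5 + m
  B = 2 + m

  layers : (Fin N → ℕ) → ℕ
  layers h = ∑[ k < B ] (count (λ x → suc (toℕ k) ≤? h x) + suc (toℕ k))

  layers-identity : ∀ h → 2 * ∑[ x < N ] (h x ⊓ B) + N + 6 + B * suc B ≡ 2 * layers h + (N + 6)
  layers-identity h = begin
    2 * S + N + 6 + B * suc B         ≡⟨ cong (λ t → 2 * S + N + 6 + t) (sym (gauss B)) ⟩
    2 * S + N + 6 + 2 * G             ≡⟨ rearrange S G N ⟩
    2 * (S + G) + (N + 6)             ≡⟨ cong (λ t → 2 * (t + G) + (N + 6)) (layer-cake h B) ⟩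
    2 * (C + G) + (N + 6)             ≡⟨ cong (λ t → 2 * t + (N + 6)) (∑-distrib-+ count≥ (λ k → suc (toℕ k))) ⟨
    2 * layers h + (N + 6)            ∎
    where
    open ≡-Reasoning
    count≥ : Fin B → ℕ
    count≥ k = count (λ x → suc (toℕ k) ≤? h x)
    S G C : ℕ
    S = ∑[ x < N ] (h x ⊓ B)
    G = ∑[ k < B ] suc (toℕ k)
    C = ∑[ k < B ] count≥ k
    rearrange : ∀ s g n → 2 * s + n + 6 + 2 * g ≡ 2 * (s + g) + (n + 6)
    rearrange = solve-∀

  square-identity : N * N + B * suc B ≡ 2 * (B * N) + (N + 6)
  square-identity = identity m
    where
    identity : ∀ m → (5 + m) * (5 + m) + (2 + m) * (3 + m) ≡ 2 * ((2 + m) * (5 + m)) + ((5 + m) + 6)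
    identity = solve-∀

  layers≤⇒⊓-transmission≤ : ∀ h → layers h ≤ B * N → 2 * ∑[ x < N ] (h x ⊓ B) + N + 6 ≤ N * N
  layers≤⇒⊓-transmission≤ h L≤ = +-cancelʳ-≤ (B * suc B) _ _ (begin
    2 * ∑[ x < N ] (h x ⊓ B) + N + 6 + B * suc B ≡⟨ layers-identity h ⟩
    2 * layers h + (N + 6)                       ≤⟨ +-monoˡ-≤ (N + 6) (*-monoʳ-≤ 2 L≤) ⟩
    2 * (B * N) + (N + 6)                        ≡⟨ square-identity ⟨
    N * N + B * suc B                            ∎)
    where open ≤-Reasoning

  ⊓-transmission≡⇔layers≡ : ∀ h → 2 * ∑[ x < N ] (h x ⊓ B) + N + 6 ≡ N * N ⇔ layers h ≡ B * N
  ⊓-transmission≡⇔layers≡ h = mk⇔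
    (λ T≡ → *-cancelˡ-≡ _ _ 2 (+-cancelʳ-≡ (N + 6) _ _ (begin
      2 * layers h + (N + 6)            ≡⟨ layers-identity h ⟨
      2 * S + N + 6 + B * suc B         ≡⟨ cong (_+ B * suc B) T≡ ⟩
      N * N + B * suc B                 ≡⟨ square-identity ⟩
      2 * (B * N) + (N + 6)             ∎)))
    (λ L≡ → +-cancelʳ-≡ (B * suc B) _ _ (begin
      2 * S + N + 6 + B * suc B         ≡⟨ layers-identity h ⟩
      2 * layers h + (N + 6)            ≡⟨ cong (λ t → 2 * t + (N + 6)) L≡ ⟩
      2 * (B * N) + (N + 6)             ≡⟨ square-identity ⟨
      N * N + B * suc B                 ∎))
    where
    open ≡-Reasoning
    S : ℕ
    S = ∑[ x < N ] (h x ⊓ B)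

  layers-toℕ : layers toℕ ≡ B * N
  layers-toℕ = trans (sum-cong-≗ {B} term≡N) (∑-const B N)
    where
    term≡N : ∀ (k : Fin B) → count (λ (x : Fin N) → suc (toℕ k) ≤? toℕ x) + suc (toℕ k) ≡ N
    term≡N k = trans (cong (_+ suc (toℕ k)) (count-≤?-toℕ N (suc (toℕ k))))
                     (m∸n+n≡m (≤-trans (toℕ<n k) (m≤n+m B 3)))

  module _ (h : Fin N → ℕ) (gap-free : ∀ {x j} → j < h x → ∃ λ y → h y ≡ j) where

    layer≤N : ∀ k → count (λ x → suc (toℕ k) ≤? h x) + suc (toℕ k) ≤ N
    layer≤N k with any? (λ x → suc (toℕ k) ≤? h x)
    ... | yes (x , k<hx) = count-≤?+k≤n h (suc (toℕ k)) (λ j j<k → gap-free (<-≤-trans j<k k<hx))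
    ... | no none = ≤-trans (≤-reflexive (cong (_+ suc (toℕ k)) nothing-above)) (≤-trans (toℕ<n k) (m≤n+m B 3))
      where
      nothing-above : count (λ x → suc (toℕ k) ≤? h x) ≡ 0
      nothing-above = count-none (λ x → suc (toℕ k) ≤? h x) (λ x k<hx → none (x , k<hx))

    layers≤ : layers h ≤ B * N
    layers≤ = ∑-≤-* layer≤N

    module _ (tight : layers h ≡ B * N) where

      count≥-tight : ∀ k → k ≤ B → count (λ x → k ≤? h x) + k ≡ N
      count≥-tight zero _ = trans (+-identityʳ _) (count-0≤? h)
      count≥-tight (suc k) k<B =
        ∀-Fin⇒∀-< (λ k → count (λ x → suc k ≤? h x) + suc k ≡ N) (∑≡*⇒≡ layer≤N tight) k k<B

      level-size : ∀ k → k < B → count (λ x → h x ≟ k) ≡ 1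
      level-size k k<B = +-cancelʳ-≡ (r + k) _ _ (begin
        count (λ x → h x ≟ k) + (r + k)   ≡⟨ +-assoc (count (λ x → h x ≟ k)) r k ⟨
        count (λ x → h x ≟ k) + r + k     ≡⟨ cong (_+ k) (count-≤?-split h k) ⟨
        count (λ x → k ≤? h x) + k        ≡⟨ count≥-tight k (<⇒≤ k<B) ⟩
        N                                 ≡⟨ count≥-tight (suc k) k<B ⟨
        r + suc k                         ≡⟨ +-suc r k ⟩
        1 + (r + k)                       ∎)
        where
        open ≡-Reasoning
        r : ℕ
        r = count (λ x → suc k ≤? h x)

      top-level-size : (∀ x → h x ≤ B) → count (λ x → h x ≟ B) ≡ 3
      top-level-size h≤B = +-cancelʳ-≡ B _ _ (begin
        count (λ x → h x ≟ B) + B         ≡⟨ cong (_+ B) (+-identityʳ _) ⟨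
        count (λ x → h x ≟ B) + 0 + B     ≡⟨ cong (λ r → count (λ x → h x ≟ B) + r + B) none-above ⟨
        count (λ x → h x ≟ B) + r + B     ≡⟨ cong (_+ B) (count-≤?-split h B) ⟨
        count (λ x → B ≤? h x) + B        ≡⟨ count≥-tight B ≤-refl ⟩
        3 + B                             ∎)
        where
        open ≡-Reasoning
        r : ℕ
        r = count (λ x → suc B ≤? h x)
        none-above : r ≡ 0
        none-above = count-none (λ x → suc B ≤? h x) (λ x → <⇒≱ (s≤s (h≤B x)))

pattern path p = inj₁ p
pattern pendant p = inj₂ (inj₁ p)
pattern extra₀₁ p = inj₂ (inj₂ (inj₁ p))
pattern extra₁₂ p = inj₂ (inj₂ (inj₂ (inj₁ p)))
pattern extra₀₂ p = inj₂ (inj₂ (inj₂ (inj₂ p)))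

module Reconstruction
  (m : ℕ) (G : Graph (5 + m)) (d : Fin (5 + m) → Fin (5 + m) → ℕ) (isD : IsDistance G d) (v : Fin (5 + m))
  (d≤ : ∀ x → d x v ≤ 2 + m)
  (path-level-unique : ∀ {x y} → d x v ≡ d y v → d x v ≤ suc m → x ≡ y)
  (leaves : Triple (λ x → d x v ≡ 2 + m))
  (i : ℕ) (extra : ExtraEdges (Adj G) i (Triple.elem leaves))
  where

  open Distance G d isD
  open Triple leaves
  open ExtraEdges extra
  open Transmission m using (N; B)

  h : Fin N → ℕ
  h x = d x v

  B≰suc-m : ¬ B ≤ suc m
  B≰suc-m = 1+n≰n

  leaf-label≰ : ∀ (j : Fin 3) → ¬ toℕ j + B ≤ suc m
  leaf-label≰ j = B≰suc-m ∘ ≤-trans (m≤n+m B (toℕ j))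

  -- Label x l: the vertex of A_{n,3}^i that x becomes, namely its distance to v on the path
  -- levels and n − 3 + j for the j-th top vertex.
  data Label (x : Fin N) (l : ℕ) : Set where
    inner : h x ≤ suc m → l ≡ h x → Label x l
    leaf  : ∀ j → x ≡ elem j → l ≡ toℕ j + B → Label x l

  classify : ∀ x → ∃ (Label x)
  classify x with h x ≤? suc m
  ... | yes hx≤ = h x , inner hx≤ refl
  ... | no hx≰ = let j , x≡ = cover (≤-antisym (d≤ x) (≰⇒> hx≰)) in toℕ j + B , leaf j x≡ refl

  label : Fin N → ℕ
  label = proj₁ ∘ classify

  label-spec : ∀ x → Label x (label x)
  label-spec = proj₂ ∘ classify

  Label-unique : ∀ {x y l} → Label x l → Label y l → x ≡ y
  Label-unique (inner hx≤ l≡) (inner _ l≡′) = path-level-unique (trans (sym l≡) l≡′) hx≤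
  Label-unique (inner hx≤ l≡) (leaf j _ l≡′) =
    contradiction (subst (_≤ suc m) (trans (sym l≡) l≡′) hx≤) (leaf-label≰ j)
  Label-unique (leaf j _ l≡) (inner hy≤ l≡′) =
    contradiction (subst (_≤ suc m) (trans (sym l≡′) l≡) hy≤) (leaf-label≰ j)
  Label-unique (leaf j x≡ l≡) (leaf j′ y≡ l≡′) =
    trans x≡ (trans (cong elem (toℕ-injective (+-cancelʳ-≡ B _ _ (trans (sym l≡) l≡′)))) (sym y≡))

  Label-leaf : ∀ {x} j → Label x (toℕ j + B) → x ≡ elem j
  Label-leaf j lx = Label-unique lx (leaf j refl refl)

  Label-inner : ∀ {x l} → Label x l → l ≤ suc m → h x ≡ l
  Label-inner (inner _ l≡) _ = sym l≡
  Label-inner (leaf j _ refl) l≤ = contradiction l≤ (leaf-label≰ j)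

  Label-top : ∀ {x l} → Label x l → B ≤ l → h x ≡ B
  Label-top (inner hx≤ refl) B≤ = contradiction (≤-trans B≤ hx≤) B≰suc-m
  Label-top (leaf j refl _) _ = elem-P j

  Label-of-inner : ∀ {x l} → Label x l → h x ≤ suc m → l ≡ h x
  Label-of-inner (inner _ l≡) _ = l≡
  Label-of-inner (leaf j refl _) hx≤ = contradiction (subst (_≤ suc m) (elem-P j) hx≤) B≰suc-m

  Label< : ∀ {x l} → Label x l → l < N
  Label< (inner hx≤ refl) = ≤-trans (s≤s hx≤) (m≤n+m _ 3)
  Label< (leaf j _ refl) = +-monoˡ-< B (toℕ<n j)

  AAdjℕ : ℕ → ℕ → Set
  AAdjℕ s t = AEdge N i s t ⊎ AEdge N i t s

  leaf-edge : ∀ j j′ → Adj G (elem j) (elem j′) → AAdjℕ (toℕ j + B) (toℕ j′ + B)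
  leaf-edge 0F 1F e = inj₁ (extra₀₁ (Equivalence.to edge₀₁ e , refl , refl))
  leaf-edge 1F 0F e = inj₂ (extra₀₁ (Equivalence.to edge₀₁ (Graph.sym G e) , refl , refl))
  leaf-edge 1F 2F e = inj₁ (extra₁₂ (Equivalence.to edge₁₂ e , refl , refl))
  leaf-edge 2F 1F e = inj₂ (extra₁₂ (Equivalence.to edge₁₂ (Graph.sym G e) , refl , refl))
  leaf-edge 0F 2F e = inj₁ (extra₀₂ (Equivalence.to edge₀₂ e , refl , refl))
  leaf-edge 2F 0F e = inj₂ (extra₀₂ (Equivalence.to edge₀₂ (Graph.sym G e) , refl , refl))
  leaf-edge 0F 0F e = contradiction e (irrefl G)
  leaf-edge 1F 1F e = contradiction e (irrefl G)
  leaf-edge 2F 2F e = contradiction e (irrefl G)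

  inner-leaf-edge : ∀ {x} j → Adj G x (elem j) → h x ≤ suc m → AEdge N i (h x) (toℕ j + B)
  inner-leaf-edge {x} j xy hx≤ =
    pendant (≤-antisym hx≤ (≤-pred (subst (_≤ suc (h x)) (elem-P j) (d-adj v (Graph.sym G xy)))) ,
             m≤n+m B (toℕ j) , +-monoˡ-< B (toℕ<n j))

  adj⇒edge : ∀ {x y s t} → Adj G x y → Label x s → Label y t → AAdjℕ s t
  adj⇒edge {x} {y} xy (inner hx≤ refl) (inner hy≤ refl) with <-cmp (h x) (h y)
  ... | tri< hx<hy _ _ = inj₁ (path (≤-antisym hx<hy (d-adj v (Graph.sym G xy)) , hy≤))
  ... | tri≈ _ hx≡hy _ = contradiction (subst (Adj G x) (sym (path-level-unique hx≡hy hx≤)) xy) (irrefl G)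
  ... | tri> _ _ hy<hx = inj₂ (path (≤-antisym hy<hx (d-adj v xy) , hx≤))
  adj⇒edge xy (inner hx≤ refl) (leaf j refl refl) = inj₁ (inner-leaf-edge j xy hx≤)
  adj⇒edge xy (leaf j refl refl) (inner hy≤ refl) = inj₂ (inner-leaf-edge j (Graph.sym G xy) hy≤)
  adj⇒edge xy (leaf j refl refl) (leaf j′ refl refl) = leaf-edge j j′ xy

  parent : ∀ {x y} → h x ≤ suc m → h y ≡ suc (h x) → Adj G x y
  parent {x} {y} hx≤ hy≡ =
    let z , yz , hz≡ = predecessor y v hy≡ in
    Graph.sym G (subst (Adj G y) (path-level-unique hz≡ (subst (_≤ suc m) (sym hz≡) hx≤)) yz)

  edge⇒adj : ∀ {x y s t} → AEdge N i s t → Label x s → Label y t → Adj G x y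
  edge⇒adj {x} {s = s} (path (refl , t≤)) lx ly =
    parent (subst (_≤ suc m) (sym hx≡) (≤-trans (n≤1+n _) t≤)) (trans (Label-inner ly t≤) (cong suc (sym hx≡)))
    where
    hx≡ : h x ≡ s
    hx≡ = Label-inner lx (≤-trans (n≤1+n _) t≤)
  edge⇒adj (pendant (refl , B≤t , _)) lx ly =
    parent (≤-reflexive (Label-inner lx ≤-refl)) (trans (Label-top ly B≤t) (cong suc (sym (Label-inner lx ≤-refl))))
  edge⇒adj (extra₀₁ (1≤i , refl , refl)) lx ly =
    subst₂ (Adj G) (sym (Label-leaf 0F lx)) (sym (Label-leaf 1F ly)) (Equivalence.from edge₀₁ 1≤i)
  edge⇒adj (extra₁₂ (2≤i , refl , refl)) lx ly =
    subst₂ (Adj G) (sym (Label-leaf 1F lx)) (sym (Label-leaf 2F ly)) (Equivalence.from edge₁₂ 2≤i)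
  edge⇒adj (extra₀₂ (3≤i , refl , refl)) lx ly =
    subst₂ (Adj G) (sym (Label-leaf 0F lx)) (sym (Label-leaf 2F ly)) (Equivalence.from edge₀₂ 3≤i)

  relabel : Fin N ↔ Fin N
  relabel = injective⇒↔ {f = toFin} toFin-injective
    where
    toFin : Fin N → Fin N
    toFin x = fromℕ< (Label< (label-spec x))
    toFin-injective : ∀ {x y} → toFin x ≡ toFin y → x ≡ y
    toFin-injective {x} {y} eq = Label-unique (label-spec x) (subst (Label y) (sym label≡) (label-spec y))
      where
      label≡ : label x ≡ label y
      label≡ = trans (sym (toℕ-fromℕ< _)) (trans (cong toℕ eq) (toℕ-fromℕ< _))

  toℕ-relabel : ∀ x → toℕ (Inverse.to relabel x) ≡ label x
  toℕ-relabel x = toℕ-fromℕ< _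

  relabel-iso : Iso G (AAdj N i) relabel
  relabel-iso x y rewrite toℕ-relabel x | toℕ-relabel y =
    (λ xy → adj⇒edge xy (label-spec x) (label-spec y)) ,
    λ { (inj₁ e) → edge⇒adj e (label-spec x) (label-spec y)
      ; (inj₂ e) → Graph.sym G (edge⇒adj e (label-spec y) (label-spec x)) }

  relabel-root : toℕ (Inverse.to relabel v) ≡ 0
  relabel-root = trans (toℕ-relabel v) (trans (Label-of-inner (label-spec v) hv≤) (d-refl v))
    where
    hv≤ : h v ≤ suc m
    hv≤ = subst (_≤ suc m) (sym (d-refl v)) z≤n

module _ {n} (h : Fin n → ℕ) (k : ℕ) where

  level : List (Fin n)
  level = filter (λ x → h x ≟ k) (allFin n)

  ∈-level : ∀ {x} → h x ≡ k ⇔ x ∈ level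
  ∈-level = ⇔.sym (∈-filter-allFin (λ x → h x ≟ k))

  length-level : length level ≡ count (λ x → h x ≟ k)
  length-level = length-filter-allFin (λ x → h x ≟ k)

module _ (m : ℕ) where

  open Transmission m

  near-top : ∀ {s t} → suc m ≤ s → suc m ≤ t → s ⊓ B ≤ suc (t ⊓ B) × t ⊓ B ≤ suc (s ⊓ B)
  near-top {s} {t} m<s m<t = ≤-trans (m⊓n≤n s B) (s≤s (⊓-glb m<t (n≤1+n _))) ,
                             ≤-trans (m⊓n≤n t B) (s≤s (⊓-glb m<s (n≤1+n _)))

  ⊓B-lipschitz : ∀ {i s t} → AEdge N i s t → s ⊓ B ≤ suc (t ⊓ B) × t ⊓ B ≤ suc (s ⊓ B)
  ⊓B-lipschitz (path (refl , _)) =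
    ⊓-mono-≤ (m≤n⇒m≤1+n (n≤1+n _)) (n≤1+n B) , ⊓-mono-≤ ≤-refl (n≤1+n B)
  ⊓B-lipschitz (pendant (refl , B≤t , _)) = near-top ≤-refl (≤-trans (n≤1+n _) B≤t)
  ⊓B-lipschitz (extra₀₁ (_ , refl , refl)) = near-top (m≤n+m _ 1) (m≤n+m _ 2)
  ⊓B-lipschitz (extra₁₂ (_ , refl , refl)) = near-top (m≤n+m _ 2) (m≤n+m _ 3)
  ⊓B-lipschitz (extra₀₂ (_ , refl , refl)) = near-top (m≤n+m _ 1) (m≤n+m _ 3)

  module _ (G : Graph N) (d : Fin N → Fin N → ℕ) (isD : IsDistance G d) (v : Fin N) where

    open Distance G d isD

    ∑⊓B≡∑ : (∀ x → d x v ≤ B) → ∑[ x < N ] (d x v ⊓ B) ≡ ∑[ x < N ] d x v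
    ∑⊓B≡∑ d≤ = sum-cong-≗ {N} (λ x → m≤n⇒m⊓n≡m (d≤ x))

    transmission-bound : (∀ x → d x v ≤ B) → 2 * ∑[ x < N ] d x v + N + 6 ≤ N * N
    transmission-bound d≤ = subst (λ S → 2 * S + N + 6 ≤ N * N) (∑⊓B≡∑ d≤)
      (layers≤⇒⊓-transmission≤ (λ x → d x v) (layers≤ (λ x → d x v) gap-free))

    A-lower-bound : ∀ {i} (f : Fin N ↔ Fin N) → Iso G (AAdj N i) f → toℕ (Inverse.to f v) ≡ 0 →
      N * N ≤ 2 * ∑[ x < N ] d x v + N + 6
    A-lower-bound f iso root = begin
      N * N                              ≡⟨ Equivalence.from (⊓-transmission≡⇔layers≡ toℕ) layers-toℕ ⟨
      2 * ∑[ y < N ] (toℕ y ⊓ B) + N + 6 ≡⟨ cong (λ S → 2 * S + N + 6) (∑-permute (λ y → toℕ y ⊓ B) f) ⟩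
      2 * ∑[ x < N ] ℓ x + N + 6         ≤⟨ +-monoˡ-≤ 6 (+-monoˡ-≤ N (*-monoʳ-≤ 2 (∑-mono-≤ ℓ≤d))) ⟩
      2 * ∑[ x < N ] d x v + N + 6       ∎
      where
      open ≤-Reasoning
      ℓ : Fin N → ℕ
      ℓ x = toℕ (Inverse.to f x) ⊓ B
      ℓ-adj : ∀ {x y} → Adj G x y → ℓ x ≤ suc (ℓ y)
      ℓ-adj {x} {y} xy with proj₁ (iso x y) xy
      ... | inj₁ e = proj₁ (⊓B-lipschitz e)
      ... | inj₂ e = proj₂ (⊓B-lipschitz e)
      ℓ≤d : ∀ x → ℓ x ≤ d x v
      ℓ≤d x = ≤-trans (walk-lipschitz ℓ ℓ-adj (shortest x v))
                      (≤-reflexive (trans (cong (λ r → d x v + r ⊓ B) root) (+-identityʳ _)))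

    extremal⇒A : (d≤ : ∀ x → d x v ≤ B) → 2 * ∑[ x < N ] d x v + N + 6 ≡ N * N →
      ∃ λ i → i ≤ 3 × Σ (Fin N ↔ Fin N) λ f → Iso G (AAdj N i) f × toℕ (Inverse.to f v) ≡ 0
    extremal⇒A d≤ T≡ =
      let i , leaves′ , i≤3 , extra = arrange (Graph.sym G) adj? leaves
          open Reconstruction m G d isD v d≤ path-level-unique leaves′ i extra
      in i , i≤3 , relabel , relabel-iso , relabel-root
      where
      h : Fin N → ℕ
      h x = d x v
      tight : layers h ≡ B * N
      tight = Equivalence.to (⊓-transmission≡⇔layers≡ h)
                (subst (λ S → 2 * S + N + 6 ≡ N * N) (sym (∑⊓B≡∑ d≤)) T≡)
      path-level-unique : ∀ {x y} → h x ≡ h y → h x ≤ suc m → x ≡ y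
      path-level-unique {x} {y} hx≡hy hx≤ =
        ∈-singleton-≡ (trans (length-level h (h x)) (level-size h gap-free tight (h x) (s≤s hx≤)))
                      (Equivalence.to (∈-level h (h x)) refl) (Equivalence.to (∈-level h (h x)) (sym hx≡hy))
      leaves : Triple (λ x → h x ≡ B)
      leaves = triple (level h B) (trans (length-level h B) (top-level-size h gap-free tight d≤)) (∈-level h B)

lemma3p11 : (n : ℕ) → 5 ≤ n → (G : Graph n) → Connected G →
    (d : Fin n → Fin n → ℕ) → IsDistance G d → DiamAtMost d (n ∸ 3) →
    (v : Fin n) →
      (2 * Trans d v + n + 6 ≤ n * n)
      × ((2 * Trans d v + n + 6 ≡ n * n) ⇔
          (∃ λ i → i ≤ 3 × (Σ (Fin n ↔ Fin n) λ f →
              Iso G (AAdj n i) f × toℕ (Inverse.to f v) ≡ 0)))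
lemma3p11 _ (s≤s (s≤s (s≤s (s≤s (s≤s {n = m} _))))) G _ d isD diam v
  rewrite sum-map-allFin (λ x → d x v) =
    upper , mk⇔ (extremal⇒A m G d isD v d≤)
                (λ (_ , _ , f , iso , root) → ≤-antisym upper (A-lower-bound m G d isD v f iso root))
  where
  d≤ : ∀ x → d x v ≤ 2 + m
  d≤ x = diam x v
  upper : 2 * ∑[ x < 5 + m ] d x v + (5 + m) + 6 ≤ (5 + m) * (5 + m)
  upper = transmission-bound m G d isD v d≤
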